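{- Let $b\ge1$. Then for all $m\ge1$, $0\le n\le bm$ and $k\ge0$, the coefficients of $w^{bm}z^nq^k$ in $$FCFS(bz,w,q)\qquad\text{and}\qquad b\int_0^zU\bigl(bt,\,we^{z-t},\,q\bigr)\,dt$$ coincide; i.e. $FCFS(bz,w,q)=b\int_0^zU(bt,we^{z-t},q)\,dt$ up to terms $w^{bm}z^nq^k$ with $n>bm$.
   Context: Hash tables: $m$ cyclically arranged buckets $1,\dots,m$ of capacity $b$; $n\le bm$ keys labelled $1,\dots,n$ with hash addresses in $\{1,\dots,m\}$, inserted in the order of their labels by linear probing with the first-come-first-served rule: each key is placed in the first non-full bucket among $h(x),h(x)+1,\dots$ (cyclically) and never moved; its displacement is the number of buckets it passes beyond its hash address. $FCFS_{m,n,k}$ is the number of pairs (assignment of hash addresses to the $n$ keys, marked key $\bullet$) such that $\bullet$ has hash address $1$ and displacement $k$; $FCFS(z,w,q)=\sum_{m\ge1}\sum_{n=1}^{bm}\sum_{k\ge0}FCFS_{m,n,k}w^{bm}\frac{z^n}{n!}q^k$. $u_{m,n}(q)$ is the probability generating function of the number of full buckets searched, starting at a given bucket, before reaching a non-full bucket, in a uniformly random table with $m$ buckets and $n$ keys ($n<bm$), and $u_{m,n}(q):=0$ for $n\ge bm$; $U(z,w,q)=\sum_{m\ge1}\sum_{n\ge0}u_{m,n}(q)w^{bm}\frac{(mz)^n}{n!}$. -}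

module Defs where

open import Data.Nat as ℕ using (ℕ; zero; suc; _≤_; _<_; _!; _≡ᵇ_; _<ᵇ_)
open import Data.Nat.Properties using (_!≢0)
open import Data.Bool using (Bool; true; false; if_then_else_; _∧_)
open import Data.List using (List; []; _∷_; map; concatMap; upTo; length; filter)
open import Data.Product using (_×_; _,_; proj₁; proj₂)
open import Data.Integer as ℤ using (ℤ; +_)
open import Data.Rational using (ℚ; 0ℚ; 1ℚ; _+_; _*_; _/_)
open import Relation.Nullary.Decidable using (does)
open import Relation.Binary.PropositionalEquality using (_≡_)

Σ< : ℕ → (ℕ → ℚ) → ℚ
Σ< zero    f = 0ℚ
Σ< (suc n) f = Σ< n f + f n

ℕtoℚ : ℕ → ℚ
ℕtoℚ n = (+ n) / 1

ℤtoℚ : ℤ → ℚ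
ℤtoℚ z = z / 1

powℚ : ℚ → ℕ → ℚ
powℚ x zero    = 1ℚ
powℚ x (suc n) = x * powℚ x n

invFact : ℕ → ℚ
invFact n = (+ 1) / (n !)
  where instance _ = n !≢0

-- 1 / m  (and 0 for m = 0, never used there)
inv : ℕ → ℚ
inv zero    = 0ℚ
inv (suc m) = (+ 1) / suc m

-- Buckets 1..m are represented by indices 0..m-1 (bucket 1 = index 0);
-- a table state is the occupancy function  occ : ℕ → ℕ  (number of keys
-- in bucket i).  The capacity is b.

next : ℕ → ℕ → ℕ
next m i = if suc i <ᵇ m then suc i else 0

fullRun : (b m : ℕ) → (ℕ → ℕ) → ℕ → (fuel : ℕ) → ℕ
fullRun b m occ i zero       = zero
fullRun b m occ i (suc fuel) =
  if occ i <ᵇ b then zero else suc (fullRun b m occ (next m i) fuel)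

step : ℕ → ℕ → ℕ → ℕ
step m i zero    = i
step m i (suc d) = step m (next m i) d

addKey : (ℕ → ℕ) → ℕ → (ℕ → ℕ)
addKey occ p x = if x ≡ᵇ p then suc (occ x) else occ x

-- Insert the keys (given by their hash addresses, in the order of their
-- labels) one by one.
insertAll : (b m : ℕ) → (ℕ → ℕ) → List ℕ → List (ℕ × ℕ) × (ℕ → ℕ)
insertAll b m occ []       = [] , occ
insertAll b m occ (h ∷ hs) =
  let d    = fullRun b m occ h m
      rest = insertAll b m (addKey occ (step m h d)) hs
  in  ((h , d) ∷ proj₁ rest) , proj₂ rest

emptyTable : ℕ → ℕ
emptyTable _ = 0

-- all assignments of hash addresses (indices 0..m-1) to keys 1..n,
-- as lists  [h(1), ..., h(n)]
assignments : ℕ → ℕ → List (List ℕ)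
assignments m zero    = [] ∷ []
assignments m (suc n) = concatMap (λ h → map (h ∷_) (assignments m n)) (upTo m)

-- FCFS_{m,n,k}: number of pairs (assignment, marked key) such that the
-- marked key has hash address 1 (index 0) and displacement k.

countMarked : ℕ → List (ℕ × ℕ) → ℕ
countMarked k []             = 0
countMarked k ((h , d) ∷ xs) =
  (if (h ≡ᵇ 0) ∧ (d ≡ᵇ k) then 1 else 0) ℕ.+ countMarked k xs

sumℕ : List ℕ → ℕ
sumℕ []       = 0
sumℕ (x ∷ xs) = x ℕ.+ sumℕ xs

FCFScount : (b m n k : ℕ) → ℕ
FCFScount b m n k =
  sumℕ (map (λ hs → countMarked k (proj₁ (insertAll b m emptyTable hs)))
            (assignments m n))

-- [q^k] u_{m,n}(q): probability (over the m^n uniform assignments) that,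
-- in the final table, starting at a given bucket (bucket 1), exactly k
-- full buckets are searched before a non-full bucket is reached;
-- defined to be 0 when n ≥ bm.
uCount : (b m n k : ℕ) → ℕ
uCount b m n k =
  length (filter (λ hs → fullRun b m (proj₂ (insertAll b m emptyTable hs)) 0 m ℕ.≟ k)
                 (assignments m n))

uCoeff : (b m n k : ℕ) → ℚ
uCoeff b m n k =
  if n <ᵇ b ℕ.* m then ℕtoℚ (uCount b m n k) * powℚ (inv m) n else 0ℚ

-- Formal power series, represented by their coefficients.
-- Ser3: coefficient of  w^a z^n q^k   (arguments a n k)
-- Ser4: coefficient of  w^a t^i z^j q^k  (arguments a i j k)

Ser3 : Set
Ser3 = ℕ → ℕ → ℕ → ℚ

Ser4 : Set
Ser4 = ℕ → ℕ → ℕ → ℕ → ℚ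

[_] : Bool → ℚ
[ true ]  = 1ℚ
[ false ] = 0ℚ

-- FCFS(z,w,q) = Σ_{m≥1} Σ_{n=1}^{bm} Σ_k FCFS_{m,n,k} w^{bm} z^n/n! q^k.
-- For b ≥ 1 only m ≤ a can satisfy bm = a, so the m-sum is finite.
FCFS : (b : ℕ) → Ser3
FCFS b a n k =
  Σ< (suc a) λ m →
    [ (1 ℕ.≤ᵇ m) ∧ (a ≡ᵇ b ℕ.* m) ∧ (1 ℕ.≤ᵇ n) ∧ (n ℕ.≤ᵇ b ℕ.* m) ]
    * ℕtoℚ (FCFScount b m n k) * invFact n

-- U(z,w,q) = Σ_{m≥1} Σ_{n≥0} u_{m,n}(q) w^{bm} (mz)^n/n!.
U : (b : ℕ) → Ser3
U b a n k =
  Σ< (suc a) λ m →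
    [ (1 ℕ.≤ᵇ m) ∧ (a ≡ᵇ b ℕ.* m) ]
    * uCoeff b m n k * powℚ (ℕtoℚ m) n * invFact n

scaleZ : ℚ → Ser3 → Ser3
scaleZ c F a n k = powℚ c n * F a n k

-- F(t, w, q) viewed as a series in w, t, z, q (no z-dependence)
zToT : Ser3 → Ser4
zToT F a i zero    k = F a i k
zToT F a i (suc j) k = 0ℚ

-- G(w e^{z-t}, t, z, q): since w^a ↦ w^a e^{az} e^{-at}, the coefficient
-- of w^a t^i z^j q^k is Σ_{i1≤i, j1≤j} G_{a,i1,j1,k} a^{j-j1}/(j-j1)! (-a)^{i-i1}/(i-i1)!.
substWExp : Ser4 → Ser4
substWExp G a i j k =
  Σ< (suc i) λ i1 → Σ< (suc j) λ j1 →
    G a i1 j1 k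
    * ℤtoℚ ((+ a) ℤ.^ (j ℕ.∸ j1)) * invFact (j ℕ.∸ j1)
    * ℤtoℚ ((ℤ.- (+ a)) ℤ.^ (i ℕ.∸ i1)) * invFact (i ℕ.∸ i1)

-- ∫_0^z G(t, z) dt : t^i z^j ↦ z^{i+j+1}/(i+1)
integrate0z : Ser4 → Ser3
integrate0z G a zero    k = 0ℚ
integrate0z G a (suc N) k =
  Σ< (suc N) λ i → G a i (N ℕ.∸ i) k * ((+ 1) / suc i)

scalar : ℚ → Ser3 → Ser3
scalar c F a n k = c * F a n k

LHS : ℕ → Ser3
LHS b = scaleZ (ℕtoℚ b) (FCFS b)

RHS : ℕ → Ser3
RHS b = scalar (ℕtoℚ b) (integrate0z (substWExp (zToT (scaleZ (ℕtoℚ b) (U b)))))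

-- Fix b, m ≥ 1, a = bm and k, and write u_i for the number of tables of i keys in which
-- a probe from bucket 1 meets exactly k full buckets (so [q^k] u_{m,i} = u_i / m^i).
-- Combinatorially, a marked key with address 1 and displacement k that is the (i+1)-st
-- key inserted sees an arbitrary table of i keys, and the keys after it are arbitrary:
--   FCFS_{m,N+1,k} = Σ_{i ≤ N} m^{N-i} u_i                    (MarkedKeyDecomposition).
-- Analytically, [w^a] of U(bt, w e^{z-t}, q) is Σ_i b^i u_i t^i/i! · e^{a(z-t)}, and
--   ∫₀^z t^i e^{a(z-t)} dt = Σ_s a^s i! z^{i+s+1}/(i+s+1)!     (ExponentialIntegral),
-- a beta integral proved by a first-order recurrence in s whose boundary term is the
-- vanishing of the positive-degree coefficients of e^{az} e^{-az}.  Both sides thus equal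
--   b^{N+1}/(N+1)! · Σ_{i ≤ N} m^{N-i} u_i  at  w^{bm} z^{N+1} q^k   (Coefficients),
-- and both vanish at z^0.  The file first collects arithmetic of ℚ and finite sums,
-- then the two main facts above, and finally extracts the coefficients of both sides.
module Submission where

open import Defs
open import Data.Nat using (ℕ)

module RationalArithmetic where

  open import Data.Nat as ℕ using (ℕ; zero; suc; _!)
  open import Data.Nat.Properties as ℕP using (_!≢0)
  open import Data.Integer as ℤ using (ℤ; +_)
  import Data.Integer.Properties as ℤP
  open import Data.Rational using (1ℚ; _+_; _*_; -_; _/_; toℚᵘ)
  open import Data.Rational.Properties
    using (toℚᵘ-injective; toℚᵘ-fromℚᵘ; toℚᵘ-homo-+; toℚᵘ-homo-*; toℚᵘ-homo‿-;
           *-identityˡ; *-identityʳ; *-assoc; *-comm)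
  import Data.Rational.Unnormalised as ℚᵘ
  import Data.Rational.Unnormalised.Properties as ℚᵘP
  open import Relation.Binary.PropositionalEquality
  open import Data.Rational.Solver using (module +-*-Solver)
  open +-*-Solver

  toℚᵘ-/ : (z : ℤ) (d : ℕ) → toℚᵘ (z / suc d) ℚᵘ.≃ ℚᵘ.mkℚᵘ z d
  toℚᵘ-/ z d = toℚᵘ-fromℚᵘ (ℚᵘ.mkℚᵘ z d)

  ℤtoℚ-+ : ∀ x y → ℤtoℚ (x ℤ.+ y) ≡ ℤtoℚ x + ℤtoℚ y
  ℤtoℚ-+ x y = toℚᵘ-injective (begin
    toℚᵘ (ℤtoℚ (x ℤ.+ y))                 ≈⟨ toℚᵘ-/ (x ℤ.+ y) 0 ⟩
    ℚᵘ.mkℚᵘ (x ℤ.+ y) 0                   ≈⟨ ℚᵘ.*≡* integers ⟩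
    ℚᵘ.mkℚᵘ x 0 ℚᵘ.+ ℚᵘ.mkℚᵘ y 0          ≈⟨ ℚᵘP.+-cong (toℚᵘ-/ x 0) (toℚᵘ-/ y 0) ⟨
    toℚᵘ (ℤtoℚ x) ℚᵘ.+ toℚᵘ (ℤtoℚ y)      ≈⟨ toℚᵘ-homo-+ (ℤtoℚ x) (ℤtoℚ y) ⟨
    toℚᵘ (ℤtoℚ x + ℤtoℚ y)                ∎)
    where
    open ℚᵘP.≃-Reasoning
    integers : (x ℤ.+ y) ℤ.* + 1 ≡ (x ℤ.* + 1 ℤ.+ y ℤ.* + 1) ℤ.* + 1
    integers rewrite ℤP.*-identityʳ x | ℤP.*-identityʳ y = refl

  ℤtoℚ-* : ∀ x y → ℤtoℚ (x ℤ.* y) ≡ ℤtoℚ x * ℤtoℚ y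
  ℤtoℚ-* x y = toℚᵘ-injective (begin
    toℚᵘ (ℤtoℚ (x ℤ.* y))                 ≈⟨ toℚᵘ-/ (x ℤ.* y) 0 ⟩
    ℚᵘ.mkℚᵘ x 0 ℚᵘ.* ℚᵘ.mkℚᵘ y 0          ≈⟨ ℚᵘP.*-cong (toℚᵘ-/ x 0) (toℚᵘ-/ y 0) ⟨
    toℚᵘ (ℤtoℚ x) ℚᵘ.* toℚᵘ (ℤtoℚ y)      ≈⟨ toℚᵘ-homo-* (ℤtoℚ x) (ℤtoℚ y) ⟨
    toℚᵘ (ℤtoℚ x * ℤtoℚ y)                ∎)
    where open ℚᵘP.≃-Reasoning

  ℤtoℚ-neg : ∀ x → ℤtoℚ (ℤ.- x) ≡ - ℤtoℚ x
  ℤtoℚ-neg x = toℚᵘ-injective (begin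
    toℚᵘ (ℤtoℚ (ℤ.- x))        ≈⟨ toℚᵘ-/ (ℤ.- x) 0 ⟩
    ℚᵘ.- ℚᵘ.mkℚᵘ x 0           ≈⟨ ℚᵘP.-‿cong (toℚᵘ-/ x 0) ⟨
    ℚᵘ.- toℚᵘ (ℤtoℚ x)         ≈⟨ toℚᵘ-homo‿- (ℤtoℚ x) ⟨
    toℚᵘ (- ℤtoℚ x)            ∎)
    where open ℚᵘP.≃-Reasoning

  ℤtoℚ-^ : ∀ x j → ℤtoℚ (x ℤ.^ j) ≡ powℚ (ℤtoℚ x) j
  ℤtoℚ-^ x zero    = refl
  ℤtoℚ-^ x (suc j) = trans (ℤtoℚ-* x (x ℤ.^ j)) (cong (ℤtoℚ x *_) (ℤtoℚ-^ x j))

  ℕtoℚ-+ : ∀ x y → ℕtoℚ (x ℕ.+ y) ≡ ℕtoℚ x + ℕtoℚ y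
  ℕtoℚ-+ x y = trans (cong ℤtoℚ (ℤP.pos-+ x y)) (ℤtoℚ-+ (+ x) (+ y))

  ℕtoℚ-* : ∀ x y → ℕtoℚ (x ℕ.* y) ≡ ℕtoℚ x * ℕtoℚ y
  ℕtoℚ-* x y = trans (cong ℤtoℚ (ℤP.pos-* x y)) (ℤtoℚ-* (+ x) (+ y))

  ℕtoℚ-^ : ∀ x j → ℕtoℚ (x ℕ.^ j) ≡ powℚ (ℕtoℚ x) j
  ℕtoℚ-^ x zero    = refl
  ℕtoℚ-^ x (suc j) = trans (ℕtoℚ-* x (x ℕ.^ j)) (cong (ℕtoℚ x *_) (ℕtoℚ-^ x j))

  powℚ-+ : ∀ x i j → powℚ x (i ℕ.+ j) ≡ powℚ x i * powℚ x j
  powℚ-+ x zero    j = sym (*-identityˡ (powℚ x j))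
  powℚ-+ x (suc i) j = trans (cong (x *_) (powℚ-+ x i j)) (sym (*-assoc x (powℚ x i) (powℚ x j)))

  powℚ-* : ∀ x y i → powℚ (x * y) i ≡ powℚ x i * powℚ y i
  powℚ-* x y zero    = refl
  powℚ-* x y (suc i) = trans (cong ((x * y) *_) (powℚ-* x y i))
    (solve 4 (λ x y p q → (x :* y) :* (p :* q) := (x :* p) :* (y :* q)) refl x y (powℚ x i) (powℚ y i))

  powℚ-1 : ∀ i → powℚ 1ℚ i ≡ 1ℚ
  powℚ-1 zero    = refl
  powℚ-1 (suc i) = trans (*-identityˡ (powℚ 1ℚ i)) (powℚ-1 i)

  cancel-invertible : ∀ {c c'} x y → c' * c ≡ 1ℚ → c * x ≡ c * y → x ≡ y
  cancel-invertible {c} {c'} x y c'c≡1 cx≡cy = begin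
    x              ≡⟨ sym (*-identityˡ x) ⟩
    1ℚ * x         ≡⟨ cong (_* x) (sym c'c≡1) ⟩
    (c' * c) * x   ≡⟨ *-assoc c' c x ⟩
    c' * (c * x)   ≡⟨ cong (c' *_) cx≡cy ⟩
    c' * (c * y)   ≡⟨ sym (*-assoc c' c y) ⟩
    (c' * c) * y   ≡⟨ cong (_* y) c'c≡1 ⟩
    1ℚ * y         ≡⟨ *-identityˡ y ⟩
    y              ∎
    where open ≡-Reasoning

  inverse-unique : ∀ {c} p q → p * c ≡ 1ℚ → q * c ≡ 1ℚ → p ≡ q
  inverse-unique {c} p q pc≡1 qc≡1 =
    cancel-invertible {c} {p} p q pc≡1 (trans (*-comm c p) (trans pc≡1 (sym (trans (*-comm c q) qc≡1))))

  inv-suc : ∀ d → inv (suc d) * ℕtoℚ (suc d) ≡ 1ℚ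
  inv-suc d = toℚᵘ-injective (begin
    toℚᵘ (inv (suc d) * ℕtoℚ (suc d))                 ≈⟨ toℚᵘ-homo-* (inv (suc d)) (ℕtoℚ (suc d)) ⟩
    toℚᵘ (inv (suc d)) ℚᵘ.* toℚᵘ (ℕtoℚ (suc d))       ≈⟨ ℚᵘP.*-cong (toℚᵘ-/ (+ 1) d) (toℚᵘ-/ (+ suc d) 0) ⟩
    ℚᵘ.mkℚᵘ (+ 1) d ℚᵘ.* ℚᵘ.mkℚᵘ (+ suc d) 0          ≈⟨ ℚᵘ.*≡* integers ⟩
    toℚᵘ 1ℚ                                           ∎)
    where
    open ℚᵘP.≃-Reasoning
    integers : (+ 1 ℤ.* + suc d) ℤ.* + 1 ≡ + 1 ℤ.* + (suc d ℕ.* 1)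
    integers = cong (λ n → + suc n)
      (trans (ℕP.*-identityʳ (d ℕ.+ 0)) (sym (cong (ℕ._+ 0) (ℕP.*-identityʳ d))))

  invFact-! : ∀ n → invFact n * ℕtoℚ (n !) ≡ 1ℚ
  invFact-! n = reciprocal (n !) {{n !≢0}}
    where
    reciprocal : ∀ d .{{_ : ℕ.NonZero d}} → ((+ 1) / d) * ℕtoℚ d ≡ 1ℚ
    reciprocal (suc d) = inv-suc d

  invFact-suc : ∀ n → invFact (suc n) * ℕtoℚ (suc n) ≡ invFact n
  invFact-suc n = inverse-unique _ _ shifted (invFact-! n)
    where
    shifted : invFact (suc n) * ℕtoℚ (suc n) * ℕtoℚ (n !) ≡ 1ℚ
    shifted = trans (*-assoc (invFact (suc n)) _ _)
      (trans (cong (invFact (suc n) *_) (sym (ℕtoℚ-* (suc n) (n !)))) (invFact-! (suc n)))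

module FiniteSums where

  open import Data.Nat as ℕ using (ℕ; zero; suc; _∸_; _<_; s≤s)
  import Data.Nat.Properties as ℕP
  open import Data.Rational using (ℚ; 0ℚ; _+_; _*_)
  open import Data.Rational.Properties
    using (+-identityˡ; +-identityʳ; +-assoc; *-comm; *-zeroʳ; *-distribˡ-+)
  open import Relation.Binary.PropositionalEquality
  open import Relation.Nullary using (¬_; yes; no)
  open import Function using (_∘_)
  open import Data.Rational.Solver using (module +-*-Solver)
  open +-*-Solver

  Σ<-cong : ∀ n {f g : ℕ → ℚ} → (∀ i → i < n → f i ≡ g i) → Σ< n f ≡ Σ< n g
  Σ<-cong zero    f≡g = refl
  Σ<-cong (suc n) f≡g = cong₂ _+_ (Σ<-cong n (λ i i<n → f≡g i (ℕP.m≤n⇒m≤1+n i<n))) (f≡g n ℕP.≤-refl)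

  Σ<-first : ∀ n f → Σ< (suc n) f ≡ f 0 + Σ< n (λ i → f (suc i))
  Σ<-first zero    f = trans (+-identityˡ (f 0)) (sym (+-identityʳ (f 0)))
  Σ<-first (suc n) f = trans (cong (_+ f (suc n)) (Σ<-first n f))
                             (+-assoc (f 0) (Σ< n (λ i → f (suc i))) (f (suc n)))

  Σ<-+ : ∀ n f g → Σ< n (λ i → f i + g i) ≡ Σ< n f + Σ< n g
  Σ<-+ zero    f g = refl
  Σ<-+ (suc n) f g = trans (cong (_+ (f n + g n)) (Σ<-+ n f g))
    (solve 4 (λ a b c d → (a :+ b) :+ (c :+ d) := (a :+ c) :+ (b :+ d)) refl (Σ< n f) (Σ< n g) (f n) (g n))

  Σ<-*ˡ : ∀ n c f → c * Σ< n f ≡ Σ< n (λ i → c * f i)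
  Σ<-*ˡ zero    c f = *-zeroʳ c
  Σ<-*ˡ (suc n) c f = trans (*-distribˡ-+ c (Σ< n f) (f n)) (cong (_+ c * f n) (Σ<-*ˡ n c f))

  Σ<-*ʳ : ∀ n c f → Σ< n f * c ≡ Σ< n (λ i → f i * c)
  Σ<-*ʳ n c f = trans (*-comm (Σ< n f) c) (trans (Σ<-*ˡ n c f) (Σ<-cong n (λ i _ → *-comm c (f i))))

  Σ<-zero : ∀ n f → (∀ i → i < n → f i ≡ 0ℚ) → Σ< n f ≡ 0ℚ
  Σ<-zero zero    f f≡0 = refl
  Σ<-zero (suc n) f f≡0 = trans (cong₂ _+_ (Σ<-zero n f (λ i i<n → f≡0 i (ℕP.m≤n⇒m≤1+n i<n)))
                                           (f≡0 n ℕP.≤-refl))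
                                (+-identityʳ 0ℚ)

  Σ<-single : ∀ n f j → j < n → (∀ i → i < n → ¬ i ≡ j → f i ≡ 0ℚ) → Σ< n f ≡ f j
  Σ<-single (suc n) f j j<1+n off with j ℕP.≟ n
  ... | yes refl = trans (cong (_+ f j) (Σ<-zero n f (λ i i<n → off i (ℕP.m≤n⇒m≤1+n i<n) (ℕP.<⇒≢ i<n))))
                         (+-identityˡ (f j))
  ... | no  j≢n  = trans (cong₂ _+_ (Σ<-single n f j j<n (λ i i<n → off i (ℕP.m≤n⇒m≤1+n i<n)))
                                    (off n ℕP.≤-refl (j≢n ∘ sym)))
                         (+-identityʳ (f j))
    where
    j<n : j < n
    j<n = ℕP.≤∧≢⇒< (ℕP.≤-pred j<1+n) j≢n

  Σ<-triangle : ∀ n (g : ℕ → ℕ → ℚ) →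
    Σ< n (λ i → Σ< (suc i) (g i)) ≡ Σ< n (λ j → Σ< (n ∸ j) (λ r → g (j ℕ.+ r) j))
  Σ<-triangle zero    g = refl
  Σ<-triangle (suc n) g = begin
    Σ< n (λ i → Σ< (suc i) (g i)) + Σ< (suc n) (g n)     ≡⟨ cong (_+ Σ< (suc n) (g n)) (Σ<-triangle n g) ⟩
    Σ< n column + Σ< (suc n) (g n)                        ≡⟨ cong (_+ Σ< (suc n) (g n)) (sym (+-identityʳ (Σ< n column))) ⟩
    Σ< n column + 0ℚ + Σ< (suc n) (g n)                   ≡⟨ cong (λ t → Σ< n column + t + Σ< (suc n) (g n)) (sym column-n) ⟩
    Σ< (suc n) column + Σ< (suc n) (g n)                  ≡⟨ sym (Σ<-+ (suc n) column (g n)) ⟩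
    Σ< (suc n) (λ j → column j + g n j)                   ≡⟨ Σ<-cong (suc n) extend ⟩
    Σ< (suc n) (λ j → Σ< (suc n ∸ j) (λ r → g (j ℕ.+ r) j)) ∎
    where
    open ≡-Reasoning
    -- the part of column j lying in rows < n
    column : ℕ → ℚ
    column j = Σ< (n ∸ j) (λ r → g (j ℕ.+ r) j)
    column-n : column n ≡ 0ℚ
    column-n = cong (λ t → Σ< t (λ r → g (n ℕ.+ r) n)) (ℕP.n∸n≡0 n)
    extend : ∀ j → j < suc n → column j + g n j ≡ Σ< (suc n ∸ j) (λ r → g (j ℕ.+ r) j)
    extend j (s≤s j≤n) rewrite ℕP.+-∸-assoc 1 j≤n =
      cong (column j +_) (cong (λ t → g t j) (sym (ℕP.m+[n∸m]≡n j≤n)))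

-- The analytic ingredient: the coefficients of ∫₀^z C(t) e^{A(z-t)} dt, computed by
-- expanding e^{A(z-t)} = e^{Az} e^{-At} and integrating t^i z^j to z^{i+j+1}/(i+1).
module ExponentialIntegral where

  open RationalArithmetic
  open FiniteSums
  open import Data.Nat as ℕ using (ℕ; zero; suc; _!; _∸_; _<_; _≤_)
  import Data.Nat.Properties as ℕP
  open import Data.Rational using (ℚ; 0ℚ; 1ℚ; _+_; _*_; -_)
  open import Data.Rational.Properties
    using (+-identityˡ; +-identityʳ; *-identityʳ; *-zeroˡ; *-zeroʳ; *-assoc; *-comm; *-distribʳ-+)
  open import Relation.Binary.PropositionalEquality
  open import Data.Rational.Solver using (module +-*-Solver)
  open +-*-Solver

  expCoeff : ℚ → ℕ → ℚ
  expCoeff x j = powℚ x j * invFact j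

  -- (e^{xz})' = x e^{xz}, coefficientwise.
  expCoeff-deriv : ∀ x j → ℕtoℚ (suc j) * expCoeff x (suc j) ≡ x * expCoeff x j
  expCoeff-deriv x j = begin
    ℕtoℚ (suc j) * (x * powℚ x j * invFact (suc j))
      ≡⟨ solve 4 (λ c x p v → c :* (x :* p :* v) := x :* (p :* (v :* c))) refl (ℕtoℚ (suc j)) x (powℚ x j) (invFact (suc j)) ⟩
    x * (powℚ x j * (invFact (suc j) * ℕtoℚ (suc j)))
      ≡⟨ cong (λ t → x * (powℚ x j * t)) (invFact-suc j) ⟩
    x * expCoeff x j ∎
    where open ≡-Reasoning

  conv : (ℕ → ℚ) → (ℕ → ℚ) → ℕ → ℚ
  conv e g s = Σ< (suc s) (λ r → e (s ∸ r) * g r)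

  Σ<-split-weight : ∀ n c (α β t : ℕ → ℚ) → (∀ r → r < n → c ≡ α r + β r) →
    c * Σ< n t ≡ Σ< n (λ r → α r * t r) + Σ< n (λ r → β r * t r)
  Σ<-split-weight n c α β t split = begin
    c * Σ< n t                                  ≡⟨ Σ<-*ˡ n c t ⟩
    Σ< n (λ r → c * t r)                        ≡⟨ Σ<-cong n (λ r r<n → trans (cong (_* t r) (split r r<n)) (*-distribʳ-+ (t r) (α r) (β r))) ⟩
    Σ< n (λ r → α r * t r + β r * t r)          ≡⟨ Σ<-+ n _ _ ⟩
    Σ< n (λ r → α r * t r) + Σ< n (λ r → β r * t r) ∎
    where open ≡-Reasoning

  ℕtoℚ-split : ∀ s r → r ≤ s → ℕtoℚ s ≡ ℕtoℚ (s ∸ r) + ℕtoℚ r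
  ℕtoℚ-split s r r≤s = trans (cong ℕtoℚ (sym (ℕP.m∸n+n≡m r≤s))) (ℕtoℚ-+ (s ∸ r) r)

  -- Product rule, part 1: the derivative falling on the left factor of a Cauchy product.
  conv-deriv-left : ∀ {x e} → (∀ j → ℕtoℚ (suc j) * e (suc j) ≡ x * e j) → ∀ g s →
    Σ< (suc (suc s)) (λ r → ℕtoℚ (suc s ∸ r) * (e (suc s ∸ r) * g r)) ≡ x * conv e g s
  conv-deriv-left {x} {e} e-deriv g s = begin
    Σ< (suc s) term + ℕtoℚ (suc s ∸ suc s) * (e (suc s ∸ suc s) * g (suc s))
      ≡⟨ cong (λ d → Σ< (suc s) term + ℕtoℚ d * (e d * g (suc s))) (ℕP.n∸n≡0 s) ⟩
    Σ< (suc s) term + 0ℚ * (e 0 * g (suc s))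
      ≡⟨ trans (cong (Σ< (suc s) term +_) (*-zeroˡ (e 0 * g (suc s)))) (+-identityʳ (Σ< (suc s) term)) ⟩
    Σ< (suc s) term
      ≡⟨ Σ<-cong (suc s) (λ r r<1+s → shift r (ℕP.≤-pred r<1+s)) ⟩
    Σ< (suc s) (λ r → x * (e (s ∸ r) * g r))
      ≡⟨ sym (Σ<-*ˡ (suc s) x _) ⟩
    x * conv e g s ∎
    where
    open ≡-Reasoning
    term : ℕ → ℚ
    term r = ℕtoℚ (suc s ∸ r) * (e (suc s ∸ r) * g r)
    shift : ∀ r → r ≤ s → term r ≡ x * (e (s ∸ r) * g r)
    shift r r≤s rewrite ℕP.+-∸-assoc 1 r≤s =
      trans (sym (*-assoc (ℕtoℚ (suc (s ∸ r))) (e (suc (s ∸ r))) (g r)))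
            (trans (cong (_* g r) (e-deriv (s ∸ r))) (*-assoc x (e (s ∸ r)) (g r)))

  -- Product rule, part 2: the derivative falling on the right factor.
  conv-deriv-right : ∀ {y g} → (∀ j → ℕtoℚ (suc j) * g (suc j) ≡ y * g j) → ∀ e s →
    Σ< (suc (suc s)) (λ r → ℕtoℚ r * (e (suc s ∸ r) * g r)) ≡ y * conv e g s
  conv-deriv-right {y} {g} g-deriv e s = begin
    Σ< (suc (suc s)) (λ r → ℕtoℚ r * (e (suc s ∸ r) * g r))
      ≡⟨ Σ<-first (suc s) (λ r → ℕtoℚ r * (e (suc s ∸ r) * g r)) ⟩
    0ℚ * (e (suc s) * g 0) + Σ< (suc s) shifted
      ≡⟨ trans (cong (_+ Σ< (suc s) shifted) (*-zeroˡ (e (suc s) * g 0))) (+-identityˡ (Σ< (suc s) shifted)) ⟩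
    Σ< (suc s) (λ r → ℕtoℚ (suc r) * (e (s ∸ r) * g (suc r)))
      ≡⟨ Σ<-cong (suc s) (λ r _ → shift r) ⟩
    Σ< (suc s) (λ r → y * (e (s ∸ r) * g r))
      ≡⟨ sym (Σ<-*ˡ (suc s) y _) ⟩
    y * conv e g s ∎
    where
    open ≡-Reasoning
    shifted : ℕ → ℚ
    shifted r = ℕtoℚ (suc r) * (e (s ∸ r) * g (suc r))
    shift : ∀ r → ℕtoℚ (suc r) * (e (s ∸ r) * g (suc r)) ≡ y * (e (s ∸ r) * g r)
    shift r = begin
      ℕtoℚ (suc r) * (e (s ∸ r) * g (suc r))
        ≡⟨ solve 3 (λ c a b → c :* (a :* b) := a :* (c :* b)) refl (ℕtoℚ (suc r)) (e (s ∸ r)) (g (suc r)) ⟩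
      e (s ∸ r) * (ℕtoℚ (suc r) * g (suc r))
        ≡⟨ cong (e (s ∸ r) *_) (g-deriv r) ⟩
      e (s ∸ r) * (y * g r)
        ≡⟨ solve 3 (λ a y b → a :* (y :* b) := y :* (a :* b)) refl (e (s ∸ r)) y (g r) ⟩
      y * (e (s ∸ r) * g r) ∎

  -- e^{Az} e^{-Az} = 1: all coefficients of positive degree vanish.
  exp-cancel : ∀ A s → conv (expCoeff A) (expCoeff (- A)) (suc s) ≡ 0ℚ
  exp-cancel A s = cancel-invertible {ℕtoℚ (suc s)} {inv (suc s)} _ _ (inv-suc s) (begin
    ℕtoℚ (suc s) * D (suc s)
      ≡⟨ Σ<-split-weight (suc (suc s)) (ℕtoℚ (suc s)) (λ r → ℕtoℚ (suc s ∸ r)) ℕtoℚ term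
           (λ r r<2+s → ℕtoℚ-split (suc s) r (ℕP.≤-pred r<2+s)) ⟩
    Σ< (suc (suc s)) (λ r → ℕtoℚ (suc s ∸ r) * term r) + Σ< (suc (suc s)) (λ r → ℕtoℚ r * term r)
      ≡⟨ cong₂ _+_ (conv-deriv-left {A} {expCoeff A} (expCoeff-deriv A) (expCoeff (- A)) s)
                   (conv-deriv-right { - A} {expCoeff (- A)} (expCoeff-deriv (- A)) (expCoeff A) s) ⟩
    A * D s + (- A) * D s
      ≡⟨ solve 2 (λ a d → a :* d :+ (:- a) :* d := con 0ℚ) refl A (D s) ⟩
    0ℚ
      ≡⟨ sym (*-zeroʳ (ℕtoℚ (suc s))) ⟩
    ℕtoℚ (suc s) * 0ℚ ∎)
    where
    open ≡-Reasoning
    D : ℕ → ℚ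
    D = conv (expCoeff A) (expCoeff (- A))
    term : ℕ → ℚ
    term r = expCoeff A (suc s ∸ r) * expCoeff (- A) r

  -- betaSum A i s is the coefficient of z^{i+s+1} in (1/i!) ∫₀^z t^i e^{A(z-t)} dt,
  -- with e^{A(z-t)} expanded as e^{Az} e^{-At}.
  betaSum : ℚ → ℕ → ℕ → ℚ
  betaSum A i = conv (expCoeff A) (λ r → expCoeff (- A) r * inv (suc (i ℕ.+ r)))

  -- Differentiating in z: (i+s+2) betaSum A i (s+1) = A betaSum A i s,
  -- the boundary term being the vanishing coefficient of e^{Az} e^{-Az}.
  betaSum-rec : ∀ A i s → ℕtoℚ (suc (suc (i ℕ.+ s))) * betaSum A i (suc s) ≡ A * betaSum A i s
  betaSum-rec A i s = begin
    ℕtoℚ (suc (suc (i ℕ.+ s))) * betaSum A i (suc s)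
      ≡⟨ Σ<-split-weight (suc (suc s)) (ℕtoℚ (suc (suc (i ℕ.+ s)))) (λ r → ℕtoℚ (suc (i ℕ.+ r))) (λ r → ℕtoℚ (suc s ∸ r)) term
           (λ r r<2+s → degree r (ℕP.≤-pred r<2+s)) ⟩
    Σ< (suc (suc s)) (λ r → ℕtoℚ (suc (i ℕ.+ r)) * term r) + Σ< (suc (suc s)) (λ r → ℕtoℚ (suc s ∸ r) * term r)
      ≡⟨ cong₂ _+_ (trans (Σ<-cong (suc (suc s)) (λ r _ → integrate r)) (exp-cancel A s))
                   (conv-deriv-left {A} {expCoeff A} (expCoeff-deriv A) (λ r → expCoeff (- A) r * inv (suc (i ℕ.+ r))) s) ⟩
    0ℚ + A * betaSum A i s
      ≡⟨ +-identityˡ _ ⟩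
    A * betaSum A i s ∎
    where
    open ≡-Reasoning
    term : ℕ → ℚ
    term r = expCoeff A (suc s ∸ r) * (expCoeff (- A) r * inv (suc (i ℕ.+ r)))
    degree : ∀ r → r ≤ suc s → ℕtoℚ (suc (suc (i ℕ.+ s))) ≡ ℕtoℚ (suc (i ℕ.+ r)) + ℕtoℚ (suc s ∸ r)
    degree r r≤1+s = trans (cong ℕtoℚ (sym total)) (ℕtoℚ-+ (suc (i ℕ.+ r)) (suc s ∸ r))
      where
      total : suc (i ℕ.+ r) ℕ.+ (suc s ∸ r) ≡ suc (suc (i ℕ.+ s))
      total = cong suc (trans (ℕP.+-assoc i r (suc s ∸ r))
                        (trans (cong (i ℕ.+_) (ℕP.m+[n∸m]≡n r≤1+s)) (ℕP.+-suc i s)))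
    integrate : ∀ r → ℕtoℚ (suc (i ℕ.+ r)) * term r ≡ expCoeff A (suc s ∸ r) * expCoeff (- A) r
    integrate r = begin
      c * (e * (f * w))     ≡⟨ solve 4 (λ c e f w → c :* (e :* (f :* w)) := e :* f :* (w :* c)) refl c e f w ⟩
      e * f * (w * c)       ≡⟨ cong (e * f *_) (inv-suc (i ℕ.+ r)) ⟩
      e * f * 1ℚ            ≡⟨ *-identityʳ (e * f) ⟩
      e * f                 ∎
      where
      c = ℕtoℚ (suc (i ℕ.+ r))
      e = expCoeff A (suc s ∸ r)
      f = expCoeff (- A) r
      w = inv (suc (i ℕ.+ r))

  betaSum-closed : ∀ A i s → betaSum A i s ≡ powℚ A s * (ℕtoℚ (i !) * invFact (suc (i ℕ.+ s)))
  betaSum-closed A i zero rewrite ℕP.+-identityʳ i = begin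
    0ℚ + 1ℚ * 1ℚ * (1ℚ * 1ℚ * inv (suc i))
      ≡⟨ solve 1 (λ w → con 0ℚ :+ con 1ℚ :* con 1ℚ :* (con 1ℚ :* con 1ℚ :* w) := con 1ℚ :* w) refl (inv (suc i)) ⟩
    1ℚ * inv (suc i)
      ≡⟨ cong (1ℚ *_) (inverse-unique (inv (suc i)) (ℕtoℚ (i !) * invFact (suc i)) (inv-suc i) i!/[i+1]!) ⟩
    1ℚ * (ℕtoℚ (i !) * invFact (suc i)) ∎
    where
    open ≡-Reasoning
    i!/[i+1]! : ℕtoℚ (i !) * invFact (suc i) * ℕtoℚ (suc i) ≡ 1ℚ
    i!/[i+1]! = begin
      ℕtoℚ (i !) * invFact (suc i) * ℕtoℚ (suc i)    ≡⟨ *-assoc (ℕtoℚ (i !)) _ _ ⟩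
      ℕtoℚ (i !) * (invFact (suc i) * ℕtoℚ (suc i))  ≡⟨ cong (ℕtoℚ (i !) *_) (invFact-suc i) ⟩
      ℕtoℚ (i !) * invFact i                         ≡⟨ *-comm (ℕtoℚ (i !)) (invFact i) ⟩
      invFact i * ℕtoℚ (i !)                         ≡⟨ invFact-! i ⟩
      1ℚ                                             ∎
  betaSum-closed A i (suc s) = cancel-invertible {c} {inv (suc (suc (i ℕ.+ s)))} _ _ (inv-suc (suc (i ℕ.+ s))) (begin
    c * betaSum A i (suc s)
      ≡⟨ betaSum-rec A i s ⟩
    A * betaSum A i s
      ≡⟨ cong (A *_) (betaSum-closed A i s) ⟩
    A * (powℚ A s * (ℕtoℚ (i !) * invFact (suc (i ℕ.+ s))))
      ≡⟨ cong (λ t → A * (powℚ A s * (ℕtoℚ (i !) * t))) (sym (invFact-suc (suc (i ℕ.+ s)))) ⟩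
    A * (powℚ A s * (ℕtoℚ (i !) * (invFact (suc (suc (i ℕ.+ s))) * c)))
      ≡⟨ solve 5 (λ a p f v c → a :* (p :* (f :* (v :* c))) := c :* (a :* p :* (f :* v))) refl
           A (powℚ A s) (ℕtoℚ (i !)) (invFact (suc (suc (i ℕ.+ s)))) c ⟩
    c * (powℚ A (suc s) * (ℕtoℚ (i !) * invFact (suc (suc (i ℕ.+ s)))))
      ≡⟨ cong (λ t → c * (powℚ A (suc s) * (ℕtoℚ (i !) * invFact (suc t)))) (sym (ℕP.+-suc i s)) ⟩
    c * (powℚ A (suc s) * (ℕtoℚ (i !) * invFact (suc (i ℕ.+ suc s)))) ∎)
    where
    open ≡-Reasoning
    c : ℚ
    c = ℕtoℚ (suc (suc (i ℕ.+ s)))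

  -- [z^{N+1}] ∫₀^z C(t) e^{A(z-t)} dt for C(t) = Σ c_i t^i, where the integrand is
  -- expanded in t^i z^j and t^i z^j integrates to z^{i+j+1}/(i+1).
  exp-integral : ∀ A (c : ℕ → ℚ) N →
    Σ< (suc N) (λ i → Σ< (suc i) (λ i₁ → c i₁ * (expCoeff A (N ∸ i) * expCoeff (- A) (i ∸ i₁))) * inv (suc i))
    ≡ Σ< (suc N) (λ i₁ → c i₁ * (powℚ A (N ∸ i₁) * (ℕtoℚ (i₁ !) * invFact (suc N))))
  exp-integral A c N = begin
    Σ< (suc N) (λ i → Σ< (suc i) (term i) * inv (suc i))
      ≡⟨ Σ<-cong (suc N) (λ i _ → Σ<-*ʳ (suc i) (inv (suc i)) (term i)) ⟩
    Σ< (suc N) (λ i → Σ< (suc i) (λ i₁ → term i i₁ * inv (suc i)))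
      ≡⟨ Σ<-triangle (suc N) (λ i i₁ → term i i₁ * inv (suc i)) ⟩
    Σ< (suc N) (λ i₁ → Σ< (suc N ∸ i₁) (λ r → term (i₁ ℕ.+ r) i₁ * inv (suc (i₁ ℕ.+ r))))
      ≡⟨ Σ<-cong (suc N) (λ i₁ i₁<1+N → column i₁ (ℕP.≤-pred i₁<1+N)) ⟩
    Σ< (suc N) (λ i₁ → c i₁ * (powℚ A (N ∸ i₁) * (ℕtoℚ (i₁ !) * invFact (suc N)))) ∎
    where
    open ≡-Reasoning
    term : ℕ → ℕ → ℚ
    term i i₁ = c i₁ * (expCoeff A (N ∸ i) * expCoeff (- A) (i ∸ i₁))
    -- the contribution of the monomial t^{i₁} of C is c_{i₁} i₁! times a beta integral
    column : ∀ i₁ → i₁ ≤ N →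
      Σ< (suc N ∸ i₁) (λ r → term (i₁ ℕ.+ r) i₁ * inv (suc (i₁ ℕ.+ r)))
      ≡ c i₁ * (powℚ A (N ∸ i₁) * (ℕtoℚ (i₁ !) * invFact (suc N)))
    column i₁ i₁≤N = begin
      Σ< (suc N ∸ i₁) (λ r → term (i₁ ℕ.+ r) i₁ * inv (suc (i₁ ℕ.+ r)))
        ≡⟨ cong (λ n → Σ< n (λ r → term (i₁ ℕ.+ r) i₁ * inv (suc (i₁ ℕ.+ r)))) (ℕP.+-∸-assoc 1 i₁≤N) ⟩
      Σ< (suc (N ∸ i₁)) (λ r → term (i₁ ℕ.+ r) i₁ * inv (suc (i₁ ℕ.+ r)))
        ≡⟨ Σ<-cong (suc (N ∸ i₁)) (λ r _ → reindex r) ⟩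
      Σ< (suc (N ∸ i₁)) (λ r → c i₁ * (expCoeff A ((N ∸ i₁) ∸ r) * (expCoeff (- A) r * inv (suc (i₁ ℕ.+ r)))))
        ≡⟨ sym (Σ<-*ˡ (suc (N ∸ i₁)) (c i₁) _) ⟩
      c i₁ * betaSum A i₁ (N ∸ i₁)
        ≡⟨ cong (c i₁ *_) (betaSum-closed A i₁ (N ∸ i₁)) ⟩
      c i₁ * (powℚ A (N ∸ i₁) * (ℕtoℚ (i₁ !) * invFact (suc (i₁ ℕ.+ (N ∸ i₁)))))
        ≡⟨ cong (λ n → c i₁ * (powℚ A (N ∸ i₁) * (ℕtoℚ (i₁ !) * invFact (suc n)))) (ℕP.m+[n∸m]≡n i₁≤N) ⟩
      c i₁ * (powℚ A (N ∸ i₁) * (ℕtoℚ (i₁ !) * invFact (suc N))) ∎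
      where
      reindex : ∀ r → term (i₁ ℕ.+ r) i₁ * inv (suc (i₁ ℕ.+ r))
                    ≡ c i₁ * (expCoeff A ((N ∸ i₁) ∸ r) * (expCoeff (- A) r * inv (suc (i₁ ℕ.+ r))))
      reindex r rewrite sym (ℕP.∸-+-assoc N i₁ r) | ℕP.m+n∸m≡n i₁ r =
        solve 4 (λ c e f w → c :* (e :* f) :* w := c :* (e :* (f :* w))) refl
          (c i₁) (expCoeff A ((N ∸ i₁) ∸ r)) (expCoeff (- A) r) (inv (suc (i₁ ℕ.+ r)))

-- The combinatorial heart: splitting FCFS_{m,n,k} according to which key is marked.
module MarkedKeyDecomposition where

  open import Data.Nat using (ℕ; zero; suc; _+_; _*_; _^_; _∸_; _≡ᵇ_)
  open import Data.Nat.Properties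
    using (+-assoc; +-identityʳ; *-assoc; *-zeroʳ; *-distribˡ-+; +-comm)
  open import Data.Bool using (true; false; if_then_else_; _∧_)
  open import Data.List using (List; []; _∷_; map; concatMap; upTo; applyUpTo; length; filter; _++_)
  open import Data.List.Properties using (map-++; map-∘; map-cong; length-upTo)
  open import Data.Product using (proj₁; proj₂)
  open import Relation.Nullary.Decidable using (does; Dec)
  open import Relation.Binary.PropositionalEquality
  open import Data.Nat.Solver using (module +-*-Solver)
  open +-*-Solver

  Σℕ< : ℕ → (ℕ → ℕ) → ℕ
  Σℕ< zero    f = 0
  Σℕ< (suc n) f = Σℕ< n f + f n

  Σℕ<-cong : ∀ n {f g : ℕ → ℕ} → (∀ i → f i ≡ g i) → Σℕ< n f ≡ Σℕ< n g
  Σℕ<-cong zero    f≡g = refl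
  Σℕ<-cong (suc n) f≡g = cong₂ _+_ (Σℕ<-cong n f≡g) (f≡g n)

  Σℕ<-first : ∀ n f → Σℕ< (suc n) f ≡ f 0 + Σℕ< n (λ i → f (suc i))
  Σℕ<-first zero    f = +-comm 0 (f 0)
  Σℕ<-first (suc n) f = trans (cong (_+ f (suc n)) (Σℕ<-first n f)) (+-assoc (f 0) _ _)

  sumℕ-++ : ∀ (xs ys : List ℕ) → sumℕ (xs ++ ys) ≡ sumℕ xs + sumℕ ys
  sumℕ-++ []       ys = refl
  sumℕ-++ (x ∷ xs) ys = trans (cong (x +_) (sumℕ-++ xs ys)) (sym (+-assoc x (sumℕ xs) (sumℕ ys)))

  module _ {A : Set} where

    sumℕ-+ : ∀ (f g : A → ℕ) xs → sumℕ (map (λ x → f x + g x) xs) ≡ sumℕ (map f xs) + sumℕ (map g xs)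
    sumℕ-+ f g []       = refl
    sumℕ-+ f g (x ∷ xs) = trans (cong (f x + g x +_) (sumℕ-+ f g xs))
      (solve 4 (λ a b c d → (a :+ b) :+ (c :+ d) := (a :+ c) :+ (b :+ d)) refl
         (f x) (g x) (sumℕ (map f xs)) (sumℕ (map g xs)))

    sumℕ-*ˡ : ∀ c (f : A → ℕ) xs → sumℕ (map (λ x → c * f x) xs) ≡ c * sumℕ (map f xs)
    sumℕ-*ˡ c f []       = sym (*-zeroʳ c)
    sumℕ-*ˡ c f (x ∷ xs) = trans (cong (c * f x +_) (sumℕ-*ˡ c f xs)) (sym (*-distribˡ-+ c (f x) _))

    sumℕ-const : ∀ c (xs : List A) → sumℕ (map (λ _ → c) xs) ≡ length xs * c
    sumℕ-const c []       = refl
    sumℕ-const c (x ∷ xs) = cong (c +_) (sumℕ-const c xs)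

    sumℕ-Σℕ< : ∀ N (f : A → ℕ → ℕ) xs →
      sumℕ (map (λ x → Σℕ< N (f x)) xs) ≡ Σℕ< N (λ i → sumℕ (map (λ x → f x i) xs))
    sumℕ-Σℕ< zero    f xs = trans (sumℕ-const 0 xs) (*-zeroʳ (length xs))
    sumℕ-Σℕ< (suc N) f xs = trans (sumℕ-+ (λ x → Σℕ< N (f x)) (λ x → f x N) xs)
                                  (cong (_+ sumℕ (map (λ x → f x N) xs)) (sumℕ-Σℕ< N f xs))

    length-filter : ∀ {P : A → Set} (P? : ∀ x → Dec (P x)) xs →
      length (filter P? xs) ≡ sumℕ (map (λ x → if does (P? x) then 1 else 0) xs)
    length-filter P? []       = refl
    length-filter P? (x ∷ xs) with does (P? x)
    ... | true  = cong suc (length-filter P? xs)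
    ... | false = length-filter P? xs

  module _ (b m' k : ℕ) where

    private
      m : ℕ
      m = suc m'

    Σseq : ℕ → (List ℕ → ℕ) → ℕ
    Σseq n f = sumℕ (map f (assignments m n))

    Σseq-suc : ∀ n f → Σseq (suc n) f ≡ sumℕ (map (λ h → Σseq n (λ hs → f (h ∷ hs))) (upTo m))
    Σseq-suc n f = go (upTo m)
      where
      extend : ℕ → List (List ℕ)
      extend h = map (h ∷_) (assignments m n)
      go : ∀ hs₀ → sumℕ (map f (concatMap extend hs₀))
                 ≡ sumℕ (map (λ h → Σseq n (λ hs → f (h ∷ hs))) hs₀)
      go []        = refl
      go (h ∷ hs₀) = begin
        sumℕ (map f (extend h ++ concatMap extend hs₀))
          ≡⟨ cong sumℕ (map-++ f (extend h) (concatMap extend hs₀)) ⟩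
        sumℕ (map f (extend h) ++ map f (concatMap extend hs₀))
          ≡⟨ sumℕ-++ (map f (extend h)) (map f (concatMap extend hs₀)) ⟩
        sumℕ (map f (extend h)) + sumℕ (map f (concatMap extend hs₀))
          ≡⟨ cong₂ _+_ (cong sumℕ (sym (map-∘ (assignments m n)))) (go hs₀) ⟩
        Σseq n (λ hs → f (h ∷ hs)) + sumℕ (map (λ h → Σseq n (λ hs → f (h ∷ hs))) hs₀) ∎
        where open ≡-Reasoning

    Σseq-const : ∀ n c → Σseq n (λ _ → c) ≡ m ^ n * c
    Σseq-const zero    c = refl
    Σseq-const (suc n) c = begin
      Σseq (suc n) (λ _ → c)                    ≡⟨ Σseq-suc n (λ _ → c) ⟩
      sumℕ (map (λ _ → Σseq n (λ _ → c)) (upTo m)) ≡⟨ sumℕ-const (Σseq n (λ _ → c)) (upTo m) ⟩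
      length (upTo m) * Σseq n (λ _ → c)          ≡⟨ cong₂ _*_ (length-upTo m) (Σseq-const n c) ⟩
      m * (m ^ n * c)                             ≡⟨ sym (*-assoc m (m ^ n) c) ⟩
      m ^ suc n * c                               ∎
      where open ≡-Reasoning

    insertOne : (ℕ → ℕ) → ℕ → (ℕ → ℕ)
    insertOne occ h = addKey occ (step m h (fullRun b m occ h m))

    probeIsK : (ℕ → ℕ) → ℕ
    probeIsK occ = if fullRun b m occ 0 m ≡ᵇ k then 1 else 0

    markedFirst : (ℕ → ℕ) → ℕ → ℕ
    markedFirst occ h = if (h ≡ᵇ 0) ∧ (fullRun b m occ h m ≡ᵇ k) then 1 else 0

    marked : (ℕ → ℕ) → List ℕ → ℕ
    marked occ hs = countMarked k (proj₁ (insertAll b m occ hs))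

    probeAfter : (ℕ → ℕ) → List ℕ → ℕ
    probeAfter occ hs = probeIsK (proj₂ (insertAll b m occ hs))

    -- Only the address h = 0 (bucket 1) can contribute a marked key.
    markedFirst-sum : ∀ occ c → sumℕ (map (λ h → c * markedFirst occ h) (upTo m)) ≡ c * probeIsK occ
    markedFirst-sum occ c = trans (cong (c * probeIsK occ +_) (later m' (λ x → x))) (+-identityʳ _)
      where
      later : ∀ n (g : ℕ → ℕ) → sumℕ (map (λ h → c * markedFirst occ h) (applyUpTo (λ x → suc (g x)) n)) ≡ 0
      later zero    g = refl
      later (suc n) g = trans (cong (c * 0 +_) (later n (λ x → g (suc x)))) (trans (+-identityʳ (c * 0)) (*-zeroʳ c))

    -- Decomposing by the position i of the marked key: the keys before it form an
    -- arbitrary table of i keys in which a probe from bucket 1 must meet exactly k full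
    -- buckets, and the N - 1 - i keys after it are arbitrary.
    marked-decomposition : ∀ N occ →
      Σseq N (marked occ) ≡ Σℕ< N (λ i → m ^ (N ∸ suc i) * Σseq i (probeAfter occ))
    marked-decomposition zero    occ = refl
    marked-decomposition (suc N) occ = begin
      Σseq (suc N) (marked occ)
        ≡⟨ Σseq-suc N (marked occ) ⟩
      sumℕ (map (λ h → Σseq N (λ hs → markedFirst occ h + marked (insertOne occ h) hs)) (upTo m))
        ≡⟨ cong sumℕ (map-cong firstKey (upTo m)) ⟩
      sumℕ (map (λ h → m ^ N * markedFirst occ h + Σseq N (marked (insertOne occ h))) (upTo m))
        ≡⟨ sumℕ-+ (λ h → m ^ N * markedFirst occ h) (λ h → Σseq N (marked (insertOne occ h))) (upTo m) ⟩
      sumℕ (map (λ h → m ^ N * markedFirst occ h) (upTo m)) + sumℕ (map (λ h → Σseq N (marked (insertOne occ h))) (upTo m))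
        ≡⟨ cong₂ _+_ (markedFirst-sum occ (m ^ N))
                     (cong sumℕ (map-cong (λ h → marked-decomposition N (insertOne occ h)) (upTo m))) ⟩
      m ^ N * probeIsK occ + sumℕ (map (λ h → Σℕ< N (rest h)) (upTo m))
        ≡⟨ cong (m ^ N * probeIsK occ +_) (sumℕ-Σℕ< N rest (upTo m)) ⟩
      m ^ N * probeIsK occ + Σℕ< N (λ i → sumℕ (map (λ h → rest h i) (upTo m)))
        ≡⟨ cong₂ _+_ (cong (m ^ N *_) (sym (+-identityʳ (probeIsK occ)))) (Σℕ<-cong N later) ⟩
      m ^ N * Σseq 0 (probeAfter occ) + Σℕ< N (λ i → m ^ (N ∸ suc i) * Σseq (suc i) (probeAfter occ))
        ≡⟨ sym (Σℕ<-first N (λ i → m ^ (suc N ∸ suc i) * Σseq i (probeAfter occ))) ⟩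
      Σℕ< (suc N) (λ i → m ^ (suc N ∸ suc i) * Σseq i (probeAfter occ)) ∎
      where
      open ≡-Reasoning
      rest : ℕ → ℕ → ℕ
      rest h i = m ^ (N ∸ suc i) * Σseq i (probeAfter (insertOne occ h))
      firstKey : ∀ h → Σseq N (λ hs → markedFirst occ h + marked (insertOne occ h) hs)
                     ≡ m ^ N * markedFirst occ h + Σseq N (marked (insertOne occ h))
      firstKey h = trans (sumℕ-+ (λ _ → markedFirst occ h) (marked (insertOne occ h)) (assignments m N))
                         (cong (_+ Σseq N (marked (insertOne occ h))) (Σseq-const N (markedFirst occ h)))
      later : ∀ i → sumℕ (map (λ h → rest h i) (upTo m)) ≡ m ^ (N ∸ suc i) * Σseq (suc i) (probeAfter occ)
      later i = trans (sumℕ-*ˡ (m ^ (N ∸ suc i)) (λ h → Σseq i (probeAfter (insertOne occ h))) (upTo m))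
                      (cong (m ^ (N ∸ suc i) *_) (sym (Σseq-suc i (probeAfter occ))))

    FCFScount-decomposition : ∀ N →
      FCFScount b m (suc N) k ≡ Σℕ< (suc N) (λ i → m ^ (N ∸ i) * uCount b m i k)
    FCFScount-decomposition N = trans (marked-decomposition (suc N) emptyTable)
      (Σℕ<-cong (suc N) (λ i → cong (m ^ (N ∸ i) *_)
        (sym (length-filter (λ hs → fullRun b m (proj₂ (insertAll b m emptyTable hs)) 0 m Data.Nat.≟ k) (assignments m i)))))

-- Substituting w ↦ w e^{z-t} into a series S(t, w, q) free of z: on w^a the factor
-- e^{a(z-t)} = e^{az} e^{-at} turns the t-coefficients into a convolution.
module Substitution where

  open RationalArithmetic
  open FiniteSums
  open ExponentialIntegral using (expCoeff)
  open import Data.Nat as ℕ using (ℕ; suc; _∸_)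
  import Data.Integer as ℤ
  open import Data.Rational using (ℚ; 0ℚ; _+_; _*_; -_)
  open import Data.Rational.Properties using (+-identityʳ)
  open import Relation.Binary.PropositionalEquality
  open import Data.Rational.Solver using (module +-*-Solver)
  open +-*-Solver

  substWExp-zToT : ∀ (S : Ser3) a i j k →
    substWExp (zToT S) a i j k
    ≡ Σ< (suc i) (λ i₁ → S a i₁ k * (expCoeff (ℕtoℚ a) j * expCoeff (- ℕtoℚ a) (i ∸ i₁)))
  substWExp-zToT S a i j k = Σ<-cong (suc i) (λ i₁ _ → begin
    Σ< (suc j) (term i₁)
      ≡⟨ Σ<-first j (term i₁) ⟩
    term i₁ 0 + Σ< j (λ j₁ → term i₁ (suc j₁))
      ≡⟨ cong (term i₁ 0 +_) (Σ<-zero j (λ j₁ → term i₁ (suc j₁)) (λ j₁ _ → free-of-z i₁ j₁)) ⟩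
    term i₁ 0 + 0ℚ
      ≡⟨ +-identityʳ (term i₁ 0) ⟩
    S a i₁ k * ℤtoℚ ((ℤ.+ a) ℤ.^ j) * invFact j * ℤtoℚ ((ℤ.- (ℤ.+ a)) ℤ.^ (i ∸ i₁)) * invFact (i ∸ i₁)
      ≡⟨ cong₂ (λ x y → S a i₁ k * x * invFact j * y * invFact (i ∸ i₁))
               (ℤtoℚ-^ (ℤ.+ a) j) (trans (ℤtoℚ-^ (ℤ.- (ℤ.+ a)) (i ∸ i₁)) (cong (λ x → powℚ x (i ∸ i₁)) (ℤtoℚ-neg (ℤ.+ a)))) ⟩
    S a i₁ k * powℚ A j * invFact j * powℚ (- A) (i ∸ i₁) * invFact (i ∸ i₁)
      ≡⟨ solve 5 (λ s p q r t → s :* p :* q :* r :* t := s :* (p :* q :* (r :* t))) refl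
           (S a i₁ k) (powℚ A j) (invFact j) (powℚ (- A) (i ∸ i₁)) (invFact (i ∸ i₁)) ⟩
    S a i₁ k * (expCoeff A j * expCoeff (- A) (i ∸ i₁)) ∎)
    where
    open ≡-Reasoning
    A : ℚ
    A = ℕtoℚ a
    term : ℕ → ℕ → ℚ
    term i₁ j₁ = zToT S a i₁ j₁ k * ℤtoℚ ((ℤ.+ a) ℤ.^ (j ∸ j₁)) * invFact (j ∸ j₁)
                 * ℤtoℚ ((ℤ.- (ℤ.+ a)) ℤ.^ (i ∸ i₁)) * invFact (i ∸ i₁)
    free-of-z : ∀ i₁ j₁ → term i₁ (suc j₁) ≡ 0ℚ
    free-of-z i₁ j₁ = solve 4 (λ x y z w → con 0ℚ :* x :* y :* z :* w := con 0ℚ) refl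
      (ℤtoℚ ((ℤ.+ a) ℤ.^ (j ∸ suc j₁))) (invFact (j ∸ suc j₁)) (ℤtoℚ ((ℤ.- (ℤ.+ a)) ℤ.^ (i ∸ i₁))) (invFact (i ∸ i₁))

module Coefficients (b' m' k : ℕ) where

  open RationalArithmetic
  open FiniteSums
  open ExponentialIntegral using (expCoeff; exp-integral)
  open MarkedKeyDecomposition using (Σℕ<; FCFScount-decomposition)
  open Substitution
  open import Data.Nat as ℕ using (ℕ; zero; suc; _!; _∸_; _<_; _≤_; s≤s; _≡ᵇ_)
  import Data.Nat.Properties as ℕP
  open import Data.Bool using (false; if_then_else_; _∧_)
  open import Data.Bool.Properties using (∧-zeroʳ)
  open import Data.Rational using (ℚ; 0ℚ; 1ℚ; _+_; _*_; -_)
  open import Data.Rational.Properties using (*-identityˡ; *-identityʳ; *-zeroˡ; *-zeroʳ)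
  open import Relation.Binary.PropositionalEquality hiding ([_])
  open import Relation.Nullary using (¬_)
  open import Relation.Nullary.Decidable using (dec-true; dec-false)
  open import Data.Rational.Solver using (module +-*-Solver)
  open +-*-Solver

  b m a : ℕ
  b = suc b'
  m = suc m'
  a = b ℕ.* m

  B M A : ℚ
  B = ℕtoℚ b
  M = ℕtoℚ m
  A = ℕtoℚ a

  -- u i = [q^k] u_{m,i}(q) · m^i, the number of tables of i keys whose probe from
  -- bucket 1 meets exactly k full buckets.
  u : ℕ → ℚ
  u i = ℕtoℚ (uCount b m i k)

  -- Since b ≥ 1, the power w^{bm} arises from the summand j = m only.
  m<1+a : m < suc a
  m<1+a = s≤s (ℕP.m≤n*m m b)

  other-power : ∀ j → ¬ j ≡ m → (a ≡ᵇ b ℕ.* j) ≡ false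
  other-power j j≢m = dec-false (a ℕ.≟ b ℕ.* j) (λ bm≡bj → j≢m (sym (ℕP.*-cancelˡ-≡ m j b bm≡bj)))

  indicator-false : ∀ {c} → c ≡ false → ∀ x y → [ c ] * x * y ≡ 0ℚ
  indicator-false c≡false x y =
    trans (cong (λ c → [ c ] * x * y) c≡false) (trans (cong (_* y) (*-zeroˡ x)) (*-zeroˡ y))

  FCFS-coefficient : ∀ N → suc N ≤ a → FCFS b a (suc N) k ≡ ℕtoℚ (FCFScount b m (suc N) k) * invFact (suc N)
  FCFS-coefficient N n≤a = begin
    FCFS b a (suc N) k
      ≡⟨ Σ<-single (suc a) _ m m<1+a (λ j _ j≢m → indicator-false
           (trans (cong (λ c → (1 ℕ.≤ᵇ j) ∧ (c ∧ (suc N ℕ.≤ᵇ b ℕ.* j))) (other-power j j≢m)) (∧-zeroʳ (1 ℕ.≤ᵇ j)))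
           (ℕtoℚ (FCFScount b j (suc N) k)) (invFact (suc N))) ⟩
    [ (a ≡ᵇ a) ∧ (suc N ℕ.≤ᵇ a) ] * ℕtoℚ (FCFScount b m (suc N) k) * invFact (suc N)
      ≡⟨ cong₂ (λ c d → [ c ∧ d ] * ℕtoℚ (FCFScount b m (suc N) k) * invFact (suc N))
               (dec-true (a ℕ.≟ a) refl) (dec-true (suc N ℕ.≤? a) n≤a) ⟩
    1ℚ * ℕtoℚ (FCFScount b m (suc N) k) * invFact (suc N)
      ≡⟨ cong (_* invFact (suc N)) (*-identityˡ (ℕtoℚ (FCFScount b m (suc N) k))) ⟩
    ℕtoℚ (FCFScount b m (suc N) k) * invFact (suc N) ∎
    where open ≡-Reasoning

  FCFS-empty : FCFS b a 0 k ≡ 0ℚ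
  FCFS-empty = Σ<-zero (suc a) _ (λ j _ → indicator-false
    (trans (cong ((1 ℕ.≤ᵇ j) ∧_) (∧-zeroʳ (a ≡ᵇ b ℕ.* j))) (∧-zeroʳ (1 ℕ.≤ᵇ j)))
    (ℕtoℚ (FCFScount b j 0 k)) (invFact 0))

  -- For i < bm, the factor m^i of (mz)^i cancels the normalisation 1/m^i of u_{m,i}.
  U-coefficient : ∀ i → i < a → U b a i k ≡ u i * invFact i
  U-coefficient i i<a = begin
    U b a i k
      ≡⟨ Σ<-single (suc a) _ m m<1+a (λ j _ j≢m → trans (cong (_* invFact i) (indicator-false
           (trans (cong ((1 ℕ.≤ᵇ j) ∧_) (other-power j j≢m)) (∧-zeroʳ (1 ℕ.≤ᵇ j)))
           (uCoeff b j i k) (powℚ (ℕtoℚ j) i))) (*-zeroˡ (invFact i))) ⟩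
    [ a ≡ᵇ a ] * uCoeff b m i k * powℚ M i * invFact i
      ≡⟨ cong₂ (λ c x → [ c ] * x * powℚ M i * invFact i) (dec-true (a ℕ.≟ a) refl) uCoeff-below ⟩
    1ℚ * (u i * powℚ (inv m) i) * powℚ M i * invFact i
      ≡⟨ solve 4 (λ u p q v → con 1ℚ :* (u :* p) :* q :* v := u :* v :* (p :* q)) refl
           (u i) (powℚ (inv m) i) (powℚ M i) (invFact i) ⟩
    u i * invFact i * (powℚ (inv m) i * powℚ M i)
      ≡⟨ cong (u i * invFact i *_) (trans (sym (powℚ-* (inv m) M i))
                                         (trans (cong (λ x → powℚ x i) (inv-suc m')) (powℚ-1 i))) ⟩
    u i * invFact i * 1ℚ
      ≡⟨ *-identityʳ (u i * invFact i) ⟩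
    u i * invFact i ∎
    where
    open ≡-Reasoning
    uCoeff-below : uCoeff b m i k ≡ u i * powℚ (inv m) i
    uCoeff-below = cong (λ c → if c then u i * powℚ (inv m) i else 0ℚ) (dec-true (i ℕ.<? a) i<a)

  ℕtoℚ-Σℕ< : ∀ n f → ℕtoℚ (Σℕ< n f) ≡ Σ< n (λ i → ℕtoℚ (f i))
  ℕtoℚ-Σℕ< zero    f = refl
  ℕtoℚ-Σℕ< (suc n) f = trans (ℕtoℚ-+ (Σℕ< n f) (f n)) (cong (_+ ℕtoℚ (f n)) (ℕtoℚ-Σℕ< n f))

  -- The common value of both sides at w^{bm} z^{N+1} q^k:
  -- b^{N+1}/(N+1)! · Σ_{i ≤ N} m^{N-i} u i.
  closedForm : ℕ → ℚ
  closedForm N = Σ< (suc N) (λ i → powℚ B (suc N) * invFact (suc N) * (powℚ M (N ∸ i) * u i))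

  LHS-closed : ∀ N → suc N ≤ a → LHS b a (suc N) k ≡ closedForm N
  LHS-closed N n≤a = begin
    powℚ B (suc N) * FCFS b a (suc N) k
      ≡⟨ cong (powℚ B (suc N) *_) (FCFS-coefficient N n≤a) ⟩
    powℚ B (suc N) * (ℕtoℚ (FCFScount b m (suc N) k) * invFact (suc N))
      ≡⟨ cong (λ x → powℚ B (suc N) * (x * invFact (suc N))) decomposition ⟩
    powℚ B (suc N) * (Σ< (suc N) counts * invFact (suc N))
      ≡⟨ solve 3 (λ x s v → x :* (s :* v) := x :* v :* s) refl (powℚ B (suc N)) (Σ< (suc N) counts) (invFact (suc N)) ⟩
    powℚ B (suc N) * invFact (suc N) * Σ< (suc N) counts
      ≡⟨ Σ<-*ˡ (suc N) (powℚ B (suc N) * invFact (suc N)) counts ⟩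
    closedForm N ∎
    where
    open ≡-Reasoning
    counts : ℕ → ℚ
    counts i = powℚ M (N ∸ i) * u i
    decomposition : ℕtoℚ (FCFScount b m (suc N) k) ≡ Σ< (suc N) counts
    decomposition = trans (cong ℕtoℚ (FCFScount-decomposition b m' k N))
      (trans (ℕtoℚ-Σℕ< (suc N) (λ i → m ℕ.^ (N ∸ i) ℕ.* uCount b m i k))
        (Σ<-cong (suc N) (λ i _ → trans (ℕtoℚ-* (m ℕ.^ (N ∸ i)) (uCount b m i k))
                                         (cong (_* u i) (ℕtoℚ-^ m (N ∸ i))))))

  RHS-closed : ∀ N → suc N ≤ a → RHS b a (suc N) k ≡ closedForm N
  RHS-closed N n≤a = begin
    B * Σ< (suc N) (λ i → substWExp (zToT (scaleZ B (U b))) a i (N ∸ i) k * inv (suc i))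
      ≡⟨ cong (B *_) (Σ<-cong (suc N) (λ i _ → cong (_* inv (suc i)) (substWExp-zToT (scaleZ B (U b)) a i (N ∸ i) k))) ⟩
    B * Σ< (suc N) (λ i → Σ< (suc i) (λ i₁ → c i₁ * (expCoeff A (N ∸ i) * expCoeff (- A) (i ∸ i₁))) * inv (suc i))
      ≡⟨ cong (B *_) (exp-integral A c N) ⟩
    B * Σ< (suc N) (λ i → c i * (powℚ A (N ∸ i) * (ℕtoℚ (i !) * invFact (suc N))))
      ≡⟨ Σ<-*ˡ (suc N) B _ ⟩
    Σ< (suc N) (λ i → B * (c i * (powℚ A (N ∸ i) * (ℕtoℚ (i !) * invFact (suc N)))))
      ≡⟨ Σ<-cong (suc N) (λ i i<1+N → monomial i (ℕP.≤-pred i<1+N)) ⟩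
    closedForm N ∎
    where
    open ≡-Reasoning
    -- coefficients of U(bt, w, q) at w^{bm} q^k
    c : ℕ → ℚ
    c i = powℚ B i * U b a i k
    monomial : ∀ i → i ≤ N →
      B * (c i * (powℚ A (N ∸ i) * (ℕtoℚ (i !) * invFact (suc N))))
      ≡ powℚ B (suc N) * invFact (suc N) * (powℚ M (N ∸ i) * u i)
    monomial i i≤N = begin
      B * (powℚ B i * U b a i k * (powℚ A (N ∸ i) * (ℕtoℚ (i !) * v)))
        ≡⟨ cong₂ (λ x y → B * (powℚ B i * x * (y * (ℕtoℚ (i !) * v))))
                 (U-coefficient i (ℕP.<-≤-trans (s≤s i≤N) n≤a))
                 (trans (cong (λ x → powℚ x (N ∸ i)) (ℕtoℚ-* b m)) (powℚ-* B M (N ∸ i))) ⟩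
      B * (powℚ B i * (u i * invFact i) * (powℚ B (N ∸ i) * powℚ M (N ∸ i) * (ℕtoℚ (i !) * v)))
        ≡⟨ solve 8 (λ B Bi u f Bs Ms F v → B :* (Bi :* (u :* f) :* (Bs :* Ms :* (F :* v)))
                                        := B :* (Bi :* Bs) :* v :* (Ms :* u) :* (f :* F)) refl
             B (powℚ B i) (u i) (invFact i) (powℚ B (N ∸ i)) (powℚ M (N ∸ i)) (ℕtoℚ (i !)) v ⟩
      B * (powℚ B i * powℚ B (N ∸ i)) * v * (powℚ M (N ∸ i) * u i) * (invFact i * ℕtoℚ (i !))
        ≡⟨ cong₂ (λ x y → B * x * v * (powℚ M (N ∸ i) * u i) * y)
                 (trans (sym (powℚ-+ B i (N ∸ i))) (cong (powℚ B) (ℕP.m+[n∸m]≡n i≤N))) (invFact-! i) ⟩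
      powℚ B (suc N) * v * (powℚ M (N ∸ i) * u i) * 1ℚ
        ≡⟨ *-identityʳ _ ⟩
      powℚ B (suc N) * v * (powℚ M (N ∸ i) * u i) ∎
      where
      v : ℚ
      v = invFact (suc N)

  -- At z^0 both sides vanish: FCFS has no constant term and ∫₀^z has none either.
  degree-zero : LHS b a 0 k ≡ RHS b a 0 k
  degree-zero = trans (cong (1ℚ *_) FCFS-empty) (trans (*-zeroʳ 1ℚ) (sym (*-zeroʳ B)))


open import Data.Nat using (zero; suc; _≤_; _*_)
open import Relation.Binary.PropositionalEquality using (_≡_; trans; sym)

theorem12p1 : (b : ℕ) → 1 ≤ b → (m : ℕ) → 1 ≤ m → (n : ℕ) → n ≤ b * m → (k : ℕ) →
    LHS b (b * m) n k ≡ RHS b (b * m) n k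
theorem12p1 (suc b') _ (suc m') _ zero    _   k = Coefficients.degree-zero b' m' k
theorem12p1 (suc b') _ (suc m') _ (suc N) n≤a k =
  trans (Coefficients.LHS-closed b' m' k N n≤a) (sym (Coefficients.RHS-closed b' m' k N n≤a))
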